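{- Let $G$ be a nilpotently vertex-transitive graph, and let $\Gamma$ be a nilpotent subgroup of $\mathrm{Aut}(G)$ of minimum order among nilpotent subgroups of $\mathrm{Aut}(G)$ acting transitively on $V(G)$. Then the stabilizer $\Gamma_u$ of every vertex $u\in V(G)$ is contained in the Frattini subgroup $\Phi(\Gamma)$.
   Context: Graphs are finite, undirected, with parallel edges allowed; vertex-transitive graphs have no loops. $\mathrm{Aut}(G)$ consists of incidence-preserving bijections of $V(G)\cup E(G)$ mapping vertices to vertices and edges to edges. $G$ is nilpotently vertex-transitive if $\mathrm{Aut}(G)$ contains a nilpotent subgroup transitive on $V(G)$. $\Phi(\Gamma)$ is the intersection of all maximal subgroups of $\Gamma$. -}

module Defs where

open import Data.Nat using (ℕ; _≤_)
open import Data.Fin using (Fin)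
open import Data.Fin.Permutation using (Permutation′; _⟨$⟩ʳ_; id; flip; _∘ₚ_)
import Data.Fin.Permutation as P
open import Data.Product using (Σ; ∃; _×_; _,_; proj₁; proj₂)
open import Data.Sum using (_⊎_)
open import Data.List using (List; length)
open import Data.List.Relation.Unary.All using (All)
open import Data.List.Relation.Unary.Any using (Any)
open import Data.List.Relation.Unary.AllPairs using (AllPairs)
open import Relation.Binary.PropositionalEquality using (_≡_; _≢_)
open import Relation.Nullary using (¬_)

-- A finite multigraph: vertex set Fin nV, edge set Fin nE, each edge has
-- two (unordered) endpoints.  Parallel edges are allowed.
record Graph : Set where
  field
    nV : ℕ
    nE : ℕ
    ends : Fin nE → Fin nV × Fin nV

open Graph public

Loopless : Graph → Set
Loopless G = ∀ e → proj₁ (ends G e) ≢ proj₂ (ends G e)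

SameEnds : ∀ {n} → Fin n × Fin n → Fin n × Fin n → Set
SameEnds (a , b) (c , d) = (a ≡ c × b ≡ d) ⊎ (a ≡ d × b ≡ c)

record Sym (G : Graph) : Set where
  constructor sym
  field
    vp : Permutation′ (nV G)
    ep : Permutation′ (nE G)

open Sym public

module _ {G : Graph} where

  _≈_ : Sym G → Sym G → Set
  g ≈ h = P._≈_ (vp g) (vp h) × P._≈_ (ep g) (ep h)

  -- group operations (product g · h = "first h, then g")
  _·_ : Sym G → Sym G → Sym G
  g · h = sym (vp h ∘ₚ vp g) (ep h ∘ₚ ep g)

  e : Sym G
  e = sym id id

  _⁻¹ : Sym G → Sym G
  g ⁻¹ = sym (flip (vp g)) (flip (ep g))

  IsAut : Sym G → Set
  IsAut g = ∀ x → SameEnds (ends G (ep g ⟨$⟩ʳ x))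
                           ((vp g ⟨$⟩ʳ proj₁ (ends G x)) , (vp g ⟨$⟩ʳ proj₂ (ends G x)))

  _∈L_ : Sym G → List (Sym G) → Set
  g ∈L L = Any (g ≈_) L

record Subgroup (G : Graph) : Set where
  field
    elems    : List (Sym G)
    auts     : All IsAut elems
    distinct : AllPairs (λ g h → ¬ (g ≈ h)) elems
    has-e    : e ∈L elems
    mul      : ∀ g h → g ∈L elems → h ∈L elems → (g · h) ∈L elems
    inv      : ∀ g → g ∈L elems → (g ⁻¹) ∈L elems

open Subgroup public

module _ {G : Graph} where

  _∈_ : Sym G → Subgroup G → Set
  g ∈ H = g ∈L elems H

  order : Subgroup G → ℕ
  order H = length (elems H)

  _⊆_ : Subgroup G → Subgroup G → Set
  H ⊆ K = ∀ g → g ∈ H → g ∈ K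

  [_,_] : Sym G → Sym G → Sym G
  [ g , h ] = ((g ⁻¹) · (h ⁻¹)) · (g · h)

  InZ : Subgroup G → ℕ → Sym G → Set
  InZ Γ ℕ.zero g = g ≈ e
  InZ Γ (ℕ.suc i) g = g ∈ Γ × (∀ h → h ∈ Γ → InZ Γ i [ g , h ])

  IsNilpotent : Subgroup G → Set
  IsNilpotent Γ = ∃ λ c → ∀ g → g ∈ Γ → InZ Γ c g

  IsTransitive : Subgroup G → Set
  IsTransitive Γ = ∀ u v → ∃ λ g → g ∈ Γ × (vp g ⟨$⟩ʳ u ≡ v)

  IsMaximal : Subgroup G → Subgroup G → Set
  IsMaximal M Γ = M ⊆ Γ × ¬ (Γ ⊆ M) ×
                  (∀ K → M ⊆ K → K ⊆ Γ → K ⊆ M ⊎ Γ ⊆ K)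

  InFrattini : Subgroup G → Sym G → Set
  InFrattini Γ g = g ∈ Γ × (∀ M → IsMaximal M Γ → g ∈ M)

NilpotentlyVT : Graph → Set
NilpotentlyVT G = ∃ λ (Γ : Subgroup G) → IsNilpotent Γ × IsTransitive Γ

-- Let M be a maximal subgroup of Γ.  In a nilpotent group a maximal subgroup is normal:
-- otherwise its normaliser would be M itself, and climbing the upper central series
-- (an element whose commutators with Γ lie in M normalises M) would put all of Γ into M.
-- Normality makes K = M Γᵤ = {k ∈ Γ : k u ∈ M u} a subgroup with M ⊆ K ⊆ Γ.  If K = M, then
-- Γᵤ ⊆ M.  If K = Γ, then M is transitive, and being a nilpotent proper subgroup it is
-- smaller than Γ, contradicting the minimality of Γ.
module Submission where

open import Level using (0ℓ)
open import Data.Nat using (ℕ; _≤_; zero; suc; s≤s; z≤n)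
open import Data.Nat.Properties using (≤-trans; ≤-reflexive; 1+n≰n)
open import Data.Fin using (Fin)
import Data.Fin.Properties as Fin
open import Data.Fin.Permutation
  using (Permutation′; _⟨$⟩ʳ_; _⟨$⟩ˡ_; inverseˡ; inverseʳ; flip; _∘ₚ_)
import Data.Fin.Permutation as Perm
open import Data.List using ([]; _∷_; length; map; filter)
open import Data.List.Properties using (length-map; length-removeAt′)
open import Data.List.Relation.Unary.All using (All; all?; lookupₛ; tabulateₛ)
import Data.List.Relation.Unary.All as All
import Data.List.Relation.Unary.All.Properties as All
open import Data.List.Relation.Unary.Any using (Any; here; there; any?)
open import Data.List.Relation.Unary.AllPairs using (_∷_)
import Data.List.Relation.Unary.AllPairs.Properties as AllPairs
import Data.List.Relation.Unary.Unique.Setoid as UniqueSetoid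
import Data.List.Relation.Unary.Unique.Setoid.Properties as Unique
import Data.List.Membership.Setoid as Membership
open import Data.List.Membership.Setoid.Properties
  using (∈-resp-≈; ∉⇒All[≉]; All[≉]⇒∉; ∈-map⁻; ∈-filter⁺; ∈-filter⁻)
import Data.List.Membership.DecSetoid as DecMembership
import Data.List.Relation.Binary.Subset.Setoid as Subset
open import Data.Product using (∃; _×_; _,_; proj₁; proj₂)
import Data.Sum as Sum
open import Data.Empty using (⊥-elim)
open import Relation.Nullary using (¬_; Dec; yes; no)
open import Relation.Nullary.Decidable using (_×-dec_)
open import Relation.Unary using (Pred; Decidable)
open import Relation.Binary using (Setoid; DecSetoid; IsEquivalence; _Respects_)
import Relation.Binary.PropositionalEquality as ≡
open ≡ using (_≡_; cong; subst; module ≡-Reasoning)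

module _ {c ℓ} (S : Setoid c ℓ) where
  open Setoid S
  open Membership S using (_─_) renaming (_∈_ to _∈ₗ_)
  open Subset S renaming (_⊆_ to _⊆ₗ_)
  open UniqueSetoid S using (Unique)

  ∈-─⁺ : ∀ {x y ys} (x∈ys : x ∈ₗ ys) → y ∈ₗ ys → ¬ x ≈ y → y ∈ₗ ys ─ x∈ys
  ∈-─⁺ (here x≈z) (here y≈z) x≉y = ⊥-elim (x≉y (trans x≈z (sym y≈z)))
  ∈-─⁺ (here _)   (there y∈ys) _ = y∈ys
  ∈-─⁺ (there _)  (here y≈z)   _ = here y≈z
  ∈-─⁺ (there x∈ys) (there y∈ys) x≉y = there (∈-─⁺ x∈ys y∈ys x≉y)

  unique-⊆⇒length≤ : ∀ {xs ys} → Unique xs → xs ⊆ₗ ys → length xs ≤ length ys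
  unique-⊆⇒length≤ {[]} _ _ = z≤n
  unique-⊆⇒length≤ {x ∷ xs} {ys} (x≉xs ∷ xs!) xs⊆ys =
    subst (suc (length xs) ≤_) (≡.sym (length-removeAt′ ys _))
      (s≤s (unique-⊆⇒length≤ xs! λ z∈xs →
        ∈-─⁺ x∈ys (xs⊆ys (there z∈xs))
             (λ x≈z → All[≉]⇒∉ S x≉xs (∈-resp-≈ S (sym x≈z) z∈xs))))
    where x∈ys = xs⊆ys (here refl)

module _ {c ℓ} (S : DecSetoid c ℓ) where
  open DecSetoid S
  open DecMembership S using (_∈?_) renaming (_∈_ to _∈ₗ_)
  open Subset setoid renaming (_⊆_ to _⊆ₗ_)
  open UniqueSetoid setoid using (Unique)

  unique-⊆-length≤⇒⊇ : ∀ {xs ys} → Unique xs → xs ⊆ₗ ys → length ys ≤ length xs → ys ⊆ₗ xs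
  unique-⊆-length≤⇒⊇ {xs} {ys} xs! xs⊆ys ys≤xs {y} y∈ys with y ∈? xs
  ... | yes y∈xs = y∈xs
  ... | no y∉xs =
    ⊥-elim (1+n≰n (≤-trans (unique-⊆⇒length≤ setoid (∉⇒All[≉] setoid y∉xs ∷ xs!) y∷xs⊆ys) ys≤xs))
    where
    y∷xs⊆ys : y ∷ xs ⊆ₗ ys
    y∷xs⊆ys (here z≈y) = ∈-resp-≈ setoid (sym z≈y) y∈ys
    y∷xs⊆ys (there z∈xs) = xs⊆ys z∈xs

  injective⇒surjective : ∀ {f : Carrier → Carrier} {xs} → Unique xs →
    (∀ {x y} → f x ≈ f y → x ≈ y) → (∀ {x} → x ∈ₗ xs → f x ∈ₗ xs) →
    ∀ {y} → y ∈ₗ xs → ∃ λ x → x ∈ₗ xs × y ≈ f x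
  injective⇒surjective {f} {xs} xs! f-inj f-closed y∈xs =
    ∈-map⁻ setoid setoid (xs⊆fxs y∈xs)
    where
    fxs⊆xs : map f xs ⊆ₗ xs
    fxs⊆xs y∈fxs with ∈-map⁻ setoid setoid y∈fxs
    ... | x , x∈xs , y≈fx = ∈-resp-≈ setoid (sym y≈fx) (f-closed x∈xs)

    xs⊆fxs : xs ⊆ₗ map f xs
    xs⊆fxs = unique-⊆-length≤⇒⊇ (Unique.map⁺ setoid setoid f-inj xs!) fxs⊆xs
                                   (≤-reflexive (≡.sym (length-map f xs)))

open import Defs

module _ {n : ℕ} where
  flip-cong : ∀ {π ρ : Permutation′ n} → π Perm.≈ ρ → flip π Perm.≈ flip ρ
  flip-cong {π} {ρ} π≈ρ i = begin
    π ⟨$⟩ˡ i                      ≡⟨ cong (π ⟨$⟩ˡ_) (≡.sym (inverseʳ ρ)) ⟩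
    π ⟨$⟩ˡ (ρ ⟨$⟩ʳ (ρ ⟨$⟩ˡ i))    ≡⟨ cong (π ⟨$⟩ˡ_) (≡.sym (π≈ρ _)) ⟩
    π ⟨$⟩ˡ (π ⟨$⟩ʳ (ρ ⟨$⟩ˡ i))    ≡⟨ inverseˡ π ⟩
    ρ ⟨$⟩ˡ i                      ∎
    where open ≡-Reasoning

  conj-inverse : ∀ (σ π ρ : Permutation′ n) →
                 (∀ i → π ⟨$⟩ʳ i ≡ σ ⟨$⟩ˡ (ρ ⟨$⟩ʳ (σ ⟨$⟩ʳ i))) →
                 ∀ i → σ ⟨$⟩ʳ (π ⟨$⟩ʳ (σ ⟨$⟩ˡ i)) ≡ ρ ⟨$⟩ʳ i
  conj-inverse σ π ρ π≈ρ^σ i = begin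
    σ ⟨$⟩ʳ (π ⟨$⟩ʳ (σ ⟨$⟩ˡ i))                         ≡⟨ cong (σ ⟨$⟩ʳ_) (π≈ρ^σ _) ⟩
    σ ⟨$⟩ʳ (σ ⟨$⟩ˡ (ρ ⟨$⟩ʳ (σ ⟨$⟩ʳ (σ ⟨$⟩ˡ i))))       ≡⟨ inverseʳ σ ⟩
    ρ ⟨$⟩ʳ (σ ⟨$⟩ʳ (σ ⟨$⟩ˡ i))                         ≡⟨ cong (ρ ⟨$⟩ʳ_) (inverseʳ σ) ⟩
    ρ ⟨$⟩ʳ i                                           ∎
    where open ≡-Reasoning

  conj-injective : ∀ (σ π ρ : Permutation′ n) →
                   (∀ i → σ ⟨$⟩ˡ (π ⟨$⟩ʳ (σ ⟨$⟩ʳ i)) ≡ σ ⟨$⟩ˡ (ρ ⟨$⟩ʳ (σ ⟨$⟩ʳ i))) →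
                   π Perm.≈ ρ
  conj-injective σ π ρ π^σ≈ρ^σ i = begin
    π ⟨$⟩ʳ i                                        ≡⟨ cong (π ⟨$⟩ʳ_) (≡.sym (inverseʳ σ)) ⟩
    π ⟨$⟩ʳ (σ ⟨$⟩ʳ (σ ⟨$⟩ˡ i))                      ≡⟨ ≡.sym (inverseʳ σ) ⟩
    σ ⟨$⟩ʳ (σ ⟨$⟩ˡ (π ⟨$⟩ʳ (σ ⟨$⟩ʳ (σ ⟨$⟩ˡ i))))
      ≡⟨ conj-inverse σ (σ ∘ₚ π ∘ₚ flip σ) ρ π^σ≈ρ^σ i ⟩
    ρ ⟨$⟩ʳ i                                        ∎
    where open ≡-Reasoning

  conj-commutator : ∀ (σ π : Permutation′ n) i →
                    σ ⟨$⟩ˡ (π ⟨$⟩ʳ (σ ⟨$⟩ʳ (π ⟨$⟩ˡ (π ⟨$⟩ʳ i)))) ≡ σ ⟨$⟩ˡ (π ⟨$⟩ʳ (σ ⟨$⟩ʳ i))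
  conj-commutator σ π i = cong (λ j → σ ⟨$⟩ˡ (π ⟨$⟩ʳ (σ ⟨$⟩ʳ j))) (inverseˡ π)

module _ {G : Graph} where

  ≈-isEquivalence : IsEquivalence (_≈_ {G})
  ≈-isEquivalence = record
    { refl  = (λ _ → ≡.refl) , (λ _ → ≡.refl)
    ; sym   = λ (p , q) → (λ i → ≡.sym (p i)) , (λ i → ≡.sym (q i))
    ; trans = λ (p , q) (p′ , q′) →
                (λ i → ≡.trans (p i) (p′ i)) , (λ i → ≡.trans (q i) (q′ i))
    }

  _≈?_ : ∀ (g h : Sym G) → Dec (g ≈ h)
  g ≈? h = Fin.all? (λ i → vp g ⟨$⟩ʳ i Fin.≟ vp h ⟨$⟩ʳ i)
     ×-dec Fin.all? (λ i → ep g ⟨$⟩ʳ i Fin.≟ ep h ⟨$⟩ʳ i)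

  infixl 8 _^_
  _^_ : Sym G → Sym G → Sym G
  m ^ k = ((k ⁻¹) · m) · k

  ^-congˡ : ∀ {m m′} k → m ≈ m′ → (m ^ k) ≈ (m′ ^ k)
  ^-congˡ k (p , q) = (λ i → cong (vp k ⟨$⟩ˡ_) (p _)) , (λ i → cong (ep k ⟨$⟩ˡ_) (q _))

  ^-congʳ : ∀ m {k k′} → k ≈ k′ → (m ^ k) ≈ (m ^ k′)
  ^-congʳ m {k} {k′} (p , q) =
    (λ i → ≡.trans (cong (λ j → vp k ⟨$⟩ˡ (vp m ⟨$⟩ʳ j)) (p i))
                   (flip-cong {π = vp k} {vp k′} p _)) ,
    (λ i → ≡.trans (cong (λ j → ep k ⟨$⟩ˡ (ep m ⟨$⟩ʳ j)) (q i))
                   (flip-cong {π = ep k} {ep k′} q _))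

  ^-injective : ∀ {m m′} k → (m ^ k) ≈ (m′ ^ k) → m ≈ m′
  ^-injective {m} {m′} k (p , q) =
    conj-injective (vp k) (vp m) (vp m′) p , conj-injective (ep k) (ep m) (ep m′) q

  ^-inverse : ∀ {m y} k → m ≈ (y ^ k) → (m ^ (k ⁻¹)) ≈ y
  ^-inverse {m} {y} k (p , q) =
    conj-inverse (vp k) (vp m) (vp y) p , conj-inverse (ep k) (ep m) (ep y) q

  commutator·≈^ : ∀ m k → ([ k , m ⁻¹ ] · m) ≈ (m ^ k)
  commutator·≈^ m k = conj-commutator (vp k) (vp m) , conj-commutator (ep k) (ep m)

Sym-decSetoid : Graph → DecSetoid 0ℓ 0ℓ
Sym-decSetoid G = record
  { Carrier = Sym G
  ; _≈_ = _≈_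
  ; isDecEquivalence = record { isEquivalence = ≈-isEquivalence ; _≟_ = _≈?_ }
  }

Sym-setoid : Graph → Setoid 0ℓ 0ℓ
Sym-setoid G = DecSetoid.setoid (Sym-decSetoid G)

module _ {G : Graph} where
  ∈-resp : ∀ (H : Subgroup G) {g h} → g ≈ h → g ∈ H → h ∈ H
  ∈-resp H {g} {h} = ∈-resp-≈ (Sym-setoid G) {elems H} {g} {h}

  ^-closed : ∀ (H : Subgroup G) m k → m ∈ H → k ∈ H → (m ^ k) ∈ H
  ^-closed H m k m∈H k∈H = mul H ((k ⁻¹) · m) k (mul H (k ⁻¹) m (inv H k k∈H) m∈H) k∈H

  commutator-closed : ∀ (H : Subgroup G) g h → g ∈ H → h ∈ H → [ g , h ] ∈ H
  commutator-closed H g h g∈H h∈H =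
    mul H ((g ⁻¹) · (h ⁻¹)) (g · h)
      (mul H (g ⁻¹) (h ⁻¹) (inv H g g∈H) (inv H h h∈H)) (mul H g h g∈H h∈H)

  ⊆∧order≤⇒⊇ : ∀ {H K : Subgroup G} → H ⊆ K → order K ≤ order H → K ⊆ H
  ⊆∧order≤⇒⊇ {H} H⊆K K≤H g =
    unique-⊆-length≤⇒⊇ (Sym-decSetoid G) (distinct H) (λ {h} → H⊆K h) K≤H {g}

  InZ-⊆ : ∀ {H Γ : Subgroup G} → H ⊆ Γ → ∀ i x → InZ Γ i x → x ∈ H → InZ H i x
  InZ-⊆ H⊆Γ zero x x≈e _ = x≈e
  InZ-⊆ {H} H⊆Γ (suc i) x (_ , [x,-]∈Zᵢ) x∈H =
    x∈H , λ h h∈H →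
      InZ-⊆ H⊆Γ i [ x , h ] ([x,-]∈Zᵢ h (H⊆Γ h h∈H)) (commutator-closed H x h x∈H h∈H)

  nilpotent-⊆ : ∀ {H Γ : Subgroup G} → H ⊆ Γ → IsNilpotent Γ → IsNilpotent H
  nilpotent-⊆ H⊆Γ (c , Γ⊆Zc) = c , λ g g∈H → InZ-⊆ H⊆Γ c g (Γ⊆Zc g (H⊆Γ g g∈H)) g∈H

module FilteredSubgroup {G : Graph} (Γ : Subgroup G) {P : Pred (Sym G) 0ℓ} (P? : Decidable P)
  (P-resp : P Respects _≈_) (P-e : P e)
  (P-· : ∀ g h → g ∈ Γ → h ∈ Γ → P g → P h → P (g · h))
  (P-⁻¹ : ∀ g → g ∈ Γ → P g → P (g ⁻¹)) where

  private S = Sym-setoid G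

  ∈⁺ : ∀ g → g ∈ Γ → P g → g ∈L filter P? (elems Γ)
  ∈⁺ g = ∈-filter⁺ S P? P-resp {g}

  ∈⁻ : ∀ g → g ∈L filter P? (elems Γ) → g ∈ Γ × P g
  ∈⁻ g = ∈-filter⁻ S P? P-resp {g}

  subgroup : Subgroup G
  subgroup = record
    { elems    = filter P? (elems Γ)
    ; auts     = All.filter⁺ P? (auts Γ)
    ; distinct = AllPairs.filter⁺ P? (distinct Γ)
    ; has-e    = ∈⁺ e (has-e Γ) P-e
    ; mul      = λ g h g∈ h∈ → let (g∈Γ , Pg) = ∈⁻ g g∈ ; (h∈Γ , Ph) = ∈⁻ h h∈ in
                   ∈⁺ (g · h) (mul Γ g h g∈Γ h∈Γ) (P-· g h g∈Γ h∈Γ Pg Ph)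
    ; inv      = λ g g∈ → let (g∈Γ , Pg) = ∈⁻ g g∈ in ∈⁺ (g ⁻¹) (inv Γ g g∈Γ) (P-⁻¹ g g∈Γ Pg)
    }

  subgroup⊆ : subgroup ⊆ Γ
  subgroup⊆ g g∈ = proj₁ (∈⁻ g g∈)

module _ {G : Graph} (M : Subgroup G) where
  open DecMembership (Sym-decSetoid G) using (_∈?_)
  open DecSetoid (Sym-decSetoid G) using () renaming (sym to ≈-sym)

  -- Quantifying over the list of elements of M (rather than over all of Sym G) keeps this decidable.
  Normalises : Sym G → Set
  Normalises k = All (λ m → (m ^ k) ∈ M) (elems M)

  normalises? : Decidable Normalises
  normalises? k = all? (λ m → (m ^ k) ∈? elems M) (elems M)

  normalises-resp : Normalises Respects _≈_
  normalises-resp {k} {k′} k≈k′ =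
    All.map (λ {m} → ∈-resp M {m ^ k} {m ^ k′} (^-congʳ m {k} {k′} k≈k′))

  normalises⇒^∈ : ∀ k → Normalises k → ∀ m → m ∈ M → (m ^ k) ∈ M
  normalises⇒^∈ k nk m =
    lookupₛ (Sym-setoid G)
      (λ {m} {m′} m≈m′ → ∈-resp M {m ^ k} {m′ ^ k} (^-congˡ {m = m} {m′} k m≈m′)) nk {m}

  ^∈⇒normalises : ∀ k → (∀ m → m ∈ M → (m ^ k) ∈ M) → Normalises k
  ^∈⇒normalises k m^k∈M = tabulateₛ (Sym-setoid G) (λ {m} → m^k∈M m)

  normalises-e : Normalises e
  normalises-e = ^∈⇒normalises e (λ _ m∈M → m∈M)

  normalises-· : ∀ g h → Normalises g → Normalises h → Normalises (g · h)
  normalises-· g h ng nh =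
    ^∈⇒normalises (g · h) (λ m m∈M → normalises⇒^∈ h nh (m ^ g) (normalises⇒^∈ g ng m m∈M))

  -- m ↦ m ^ k is an injective self-map of the finite set M, hence onto M.
  normalises-⁻¹ : ∀ k → Normalises k → Normalises (k ⁻¹)
  normalises-⁻¹ k nk = ^∈⇒normalises (k ⁻¹) λ m m∈M →
    let (y , y∈M , m≈y^k) = injective⇒surjective (Sym-decSetoid G) {f = _^ k} (distinct M)
                              (λ {x} {y} → ^-injective {m = x} {y} k)
                              (λ {m} → normalises⇒^∈ k nk m) {m} m∈M
    in ∈-resp M {y} {m ^ (k ⁻¹)} (≈-sym {m ^ (k ⁻¹)} {y} (^-inverse {m = m} {y} k m≈y^k)) y∈M

  Normal : Subgroup G → Set
  Normal Γ = ∀ k → k ∈ Γ → Normalises k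

  module Normaliser (Γ : Subgroup G) =
    FilteredSubgroup Γ {Normalises} normalises? (λ {k} {k′} → normalises-resp {k} {k′})
                     normalises-e (λ g h _ _ → normalises-· g h) (λ k _ → normalises-⁻¹ k)

module _ {G : Graph} {Γ M : Subgroup G} (M⊆Γ : M ⊆ Γ) where
  open Normaliser M Γ using (∈⁺; ∈⁻) renaming (subgroup to N)
  open DecSetoid (Sym-decSetoid G) using () renaming (sym to ≈-sym)

  ⊆-normaliser : M ⊆ N
  ⊆-normaliser m m∈M =
    ∈⁺ m (M⊆Γ m m∈M) (^∈⇒normalises M m λ m′ m′∈M → ^-closed M m′ m m′∈M m∈M)

  -- Since m ^ x = [ x , m ⁻¹ ] · m, an x whose commutators with Γ lie in M normalises M.
  normaliser⊆⇒upperCentral⊆ : N ⊆ M → ∀ i x → InZ Γ i x → x ∈ M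
  normaliser⊆⇒upperCentral⊆ N⊆M zero x x≈e = ∈-resp M {e} {x} (≈-sym {x} {e} x≈e) (has-e M)
  normaliser⊆⇒upperCentral⊆ N⊆M (suc i) x (x∈Γ , [x,-]∈Zᵢ) =
    N⊆M x (∈⁺ x x∈Γ (^∈⇒normalises M x λ m m∈M →
      ∈-resp M {[ x , m ⁻¹ ] · m} {m ^ x} (commutator·≈^ m x)
        (mul M [ x , m ⁻¹ ] m
          (normaliser⊆⇒upperCentral⊆ N⊆M i [ x , m ⁻¹ ]
            ([x,-]∈Zᵢ (m ⁻¹) (M⊆Γ (m ⁻¹) (inv M m m∈M))))
          m∈M)))

maximal⇒normal : ∀ {G} {Γ M : Subgroup G} → IsNilpotent Γ → IsMaximal M Γ → Normal M Γ
maximal⇒normal {Γ = Γ} {M} (c , Γ⊆Zc) (M⊆Γ , Γ⊈M , maximal) k k∈Γ =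
  Sum.[ (λ N⊆M → ⊥-elim (Γ⊈M λ g g∈Γ →
           normaliser⊆⇒upperCentral⊆ {Γ = Γ} {M} M⊆Γ N⊆M c g (Γ⊆Zc g g∈Γ)))
      , (λ Γ⊆N → proj₂ (∈⁻ k (Γ⊆N k k∈Γ)))
      ]′ (maximal N (⊆-normaliser {Γ = Γ} {M} M⊆Γ) subgroup⊆)
  where open Normaliser M Γ using (∈⁻; subgroup⊆) renaming (subgroup to N)

module _ {G : Graph} (M : Subgroup G) (u : Fin (nV G)) where
  open Membership (Sym-setoid G) using (find; lose)

  InOrbit : Fin (nV G) → Set
  InOrbit v = Any (λ m → vp m ⟨$⟩ʳ u ≡ v) (elems M)

  inOrbit? : Decidable InOrbit
  inOrbit? v = any? (λ m → vp m ⟨$⟩ʳ u Fin.≟ v) (elems M)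

  inOrbit⁺ : ∀ m {v} → m ∈ M → vp m ⟨$⟩ʳ u ≡ v → InOrbit v
  inOrbit⁺ m = lose (λ (p , _) mu≡v → ≡.trans (≡.sym (p u)) mu≡v) {m}

  inOrbit⁻ : ∀ {v} → InOrbit v → ∃ λ m → m ∈ M × vp m ⟨$⟩ʳ u ≡ v
  inOrbit⁻ = find

  orbit-total⇒transitive : (∀ v → InOrbit v) → IsTransitive M
  orbit-total⇒transitive total v w
    with inOrbit⁻ (total v) | inOrbit⁻ (total w)
  ... | m₁ , m₁∈M , m₁u≡v | m₂ , m₂∈M , m₂u≡w =
    m₂ · (m₁ ⁻¹) , mul M m₂ (m₁ ⁻¹) m₂∈M (inv M m₁ m₁∈M) , (begin
      vp m₂ ⟨$⟩ʳ (vp m₁ ⟨$⟩ˡ v)              ≡⟨ cong (λ j → vp m₂ ⟨$⟩ʳ (vp m₁ ⟨$⟩ˡ j)) (≡.sym m₁u≡v) ⟩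
      vp m₂ ⟨$⟩ʳ (vp m₁ ⟨$⟩ˡ (vp m₁ ⟨$⟩ʳ u))  ≡⟨ cong (vp m₂ ⟨$⟩ʳ_) (inverseˡ (vp m₁)) ⟩
      vp m₂ ⟨$⟩ʳ u                           ≡⟨ m₂u≡w ⟩
      w                                      ∎)
    where open ≡-Reasoning

  -- The product M Γᵤ, presented as {k ∈ Γ : k u ∈ M u}.
  module StabiliserProduct (Γ : Subgroup G) (M⊆Γ : M ⊆ Γ) (M⊴Γ : Normal M Γ) where

    MovesIntoOrbit : Pred (Sym G) 0ℓ
    MovesIntoOrbit k = InOrbit (vp k ⟨$⟩ʳ u)

    private
      movesIntoOrbit-resp : MovesIntoOrbit Respects _≈_
      movesIntoOrbit-resp (p , _) = subst InOrbit (p u)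

      movesIntoOrbit-· : ∀ g h → g ∈ Γ → h ∈ Γ →
                         MovesIntoOrbit g → MovesIntoOrbit h → MovesIntoOrbit (g · h)
      movesIntoOrbit-· g h g∈Γ _ gu∈Mu hu∈Mu
        with inOrbit⁻ gu∈Mu | inOrbit⁻ hu∈Mu
      ... | m₁ , m₁∈M , m₁u≡gu | m₂ , m₂∈M , m₂u≡hu =
        inOrbit⁺ ((m₂ ^ (g ⁻¹)) · m₁) (mul M (m₂ ^ (g ⁻¹)) m₁ m₂^g⁻¹∈M m₁∈M) (begin
          vp g ⟨$⟩ʳ (vp m₂ ⟨$⟩ʳ (vp g ⟨$⟩ˡ (vp m₁ ⟨$⟩ʳ u)))
            ≡⟨ cong (λ j → vp g ⟨$⟩ʳ (vp m₂ ⟨$⟩ʳ (vp g ⟨$⟩ˡ j))) m₁u≡gu ⟩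
          vp g ⟨$⟩ʳ (vp m₂ ⟨$⟩ʳ (vp g ⟨$⟩ˡ (vp g ⟨$⟩ʳ u)))
            ≡⟨ cong (λ j → vp g ⟨$⟩ʳ (vp m₂ ⟨$⟩ʳ j)) (inverseˡ (vp g)) ⟩
          vp g ⟨$⟩ʳ (vp m₂ ⟨$⟩ʳ u)
            ≡⟨ cong (vp g ⟨$⟩ʳ_) m₂u≡hu ⟩
          vp g ⟨$⟩ʳ (vp h ⟨$⟩ʳ u)
            ∎)
        where
        open ≡-Reasoning
        m₂^g⁻¹∈M : (m₂ ^ (g ⁻¹)) ∈ M
        m₂^g⁻¹∈M = normalises⇒^∈ M (g ⁻¹) (normalises-⁻¹ M g (M⊴Γ g g∈Γ)) m₂ m₂∈M

      movesIntoOrbit-⁻¹ : ∀ g → g ∈ Γ → MovesIntoOrbit g → MovesIntoOrbit (g ⁻¹)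
      movesIntoOrbit-⁻¹ g g∈Γ gu∈Mu with inOrbit⁻ gu∈Mu
      ... | m , m∈M , mu≡gu =
        inOrbit⁺ (m ⁻¹ ^ g) (normalises⇒^∈ M g (M⊴Γ g g∈Γ) (m ⁻¹) (inv M m m∈M)) (begin
          vp g ⟨$⟩ˡ (vp m ⟨$⟩ˡ (vp g ⟨$⟩ʳ u))
            ≡⟨ cong (λ j → vp g ⟨$⟩ˡ (vp m ⟨$⟩ˡ j)) (≡.sym mu≡gu) ⟩
          vp g ⟨$⟩ˡ (vp m ⟨$⟩ˡ (vp m ⟨$⟩ʳ u))
            ≡⟨ cong (vp g ⟨$⟩ˡ_) (inverseˡ (vp m)) ⟩
          vp g ⟨$⟩ˡ u
            ∎)
        where open ≡-Reasoning

    open FilteredSubgroup Γ {MovesIntoOrbit} (λ k → inOrbit? (vp k ⟨$⟩ʳ u))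
      (λ {g} {h} → movesIntoOrbit-resp {g} {h}) (inOrbit⁺ e (has-e M) ≡.refl)
      movesIntoOrbit-· movesIntoOrbit-⁻¹ public

    M⊆MΓᵤ : M ⊆ subgroup
    M⊆MΓᵤ m m∈M = ∈⁺ m (M⊆Γ m m∈M) (inOrbit⁺ m m∈M ≡.refl)

    stabiliser⊆MΓᵤ : ∀ g → g ∈ Γ → vp g ⟨$⟩ʳ u ≡ u → g ∈ subgroup
    stabiliser⊆MΓᵤ g g∈Γ gu≡u = ∈⁺ g g∈Γ (inOrbit⁺ e (has-e M) (≡.sym gu≡u))

    Γ⊆MΓᵤ⇒transitive : IsTransitive Γ → Γ ⊆ subgroup → IsTransitive M
    Γ⊆MΓᵤ⇒transitive Γ-transitive Γ⊆MΓᵤ = orbit-total⇒transitive λ v →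
      let (k , k∈Γ , ku≡v) = Γ-transitive u v
      in subst InOrbit ku≡v (proj₂ (∈⁻ k (Γ⊆MΓᵤ k k∈Γ)))

stabiliser⊆maximal : ∀ {G} {Γ M : Subgroup G} →
  IsNilpotent Γ → IsTransitive Γ →
  (∀ (Δ : Subgroup G) → IsNilpotent Δ → IsTransitive Δ → order Γ ≤ order Δ) →
  IsMaximal M Γ → ∀ u g → g ∈ Γ → vp g ⟨$⟩ʳ u ≡ u → g ∈ M
stabiliser⊆maximal {Γ = Γ} {M} Γ-nilpotent Γ-transitive Γ-minimal
                   M-maximal@(M⊆Γ , Γ⊈M , maximal) u g g∈Γ gu≡u =
  Sum.[ (λ MΓᵤ⊆M → MΓᵤ⊆M g (stabiliser⊆MΓᵤ g g∈Γ gu≡u))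
      , (λ Γ⊆MΓᵤ → ⊥-elim (Γ⊈M (⊆∧order≤⇒⊇ {H = M} {Γ} M⊆Γ
           (Γ-minimal M (nilpotent-⊆ {H = M} {Γ} M⊆Γ Γ-nilpotent)
                        (Γ⊆MΓᵤ⇒transitive Γ-transitive Γ⊆MΓᵤ)))))
      ]′ (maximal MΓᵤ M⊆MΓᵤ subgroup⊆)
  where open StabiliserProduct M u Γ M⊆Γ (maximal⇒normal {Γ = Γ} {M} Γ-nilpotent M-maximal)
          renaming (subgroup to MΓᵤ)

lemma4p5 : (G : Graph) → Loopless G → NilpotentlyVT G →
    (Γ : Subgroup G) → IsNilpotent Γ → IsTransitive Γ →
    (∀ (Δ : Subgroup G) → IsNilpotent Δ → IsTransitive Δ → order Γ ≤ order Δ) →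
    ∀ (u : Fin (nV G)) (g : Sym G) → g ∈ Γ → vp g ⟨$⟩ʳ u ≡ u → InFrattini Γ g
lemma4p5 G _ _ Γ Γ-nilpotent Γ-transitive Γ-minimal u g g∈Γ gu≡u =
  g∈Γ , λ M M-maximal →
    stabiliser⊆maximal {Γ = Γ} {M} Γ-nilpotent Γ-transitive Γ-minimal M-maximal
                       u g g∈Γ gu≡u
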